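{- A nonnegative integer $p$ is the Mostar index of some finite tree if and only if $p$ is even.
   Context: For a connected graph $G$ and an edge $uv\in E(G)$, let $n_u$ be the number of vertices of $G$ strictly closer (in shortest-path distance) to $u$ than to $v$, and $n_v$ analogously. The Mostar index is $Mo(G)=\sum_{uv\in E(G)}|n_u-n_v|$. -}

module Defs where

open import Data.Nat using (ℕ; zero; suc; _+_; _<_; _≤_; _∸_)
open import Data.Nat.Properties using (_≟_)
open import Data.Bool using (Bool; true; false; _∨_; _∧_; not; T)
open import Data.Fin using (Fin; toℕ)
open import Data.Fin.Properties using () renaming (_≟_ to _≟ᶠ_)
open import Data.List using (List; []; _∷_; length; map; filter; allFin; concatMap)
open import Data.Bool.ListAction using (any)
open import Data.Nat.ListAction using (sum)
open import Data.List.Relation.Unary.Unique.Propositional using (Unique)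
open import Data.List.Relation.Unary.All using (All)
open import Data.Product using (Σ; _×_; ∃; _,_)
open import Relation.Nullary.Decidable using (⌊_⌋; does)
open import Relation.Binary.PropositionalEquality using (_≡_)

record Graph (n : ℕ) : Set where
  field
    adj   : Fin n → Fin n → Bool
    sym   : ∀ u v → adj u v ≡ adj v u
    irrefl : ∀ u → adj u u ≡ false
open Graph public

∣_-_∣ : ℕ → ℕ → ℕ
∣ zero - m ∣ = m
∣ suc n - zero ∣ = suc n
∣ suc n - suc m ∣ = ∣ n - m ∣

data Walk {n : ℕ} (G : Graph n) : Fin n → Fin n → List (Fin n) → Set where
  here  : ∀ u → Walk G u u (u ∷ [])
  step  : ∀ {u w v vs} → T (adj G u w) → Walk G w v vs → Walk G u v (u ∷ vs)

Connected : ∀ {n} → Graph n → Set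
Connected {n} G = ∀ (u v : Fin n) → ∃ λ vs → Walk G u v vs

-- A cycle: a closed walk x₀ x₁ … x_{k} x₀ with k+1 ≥ 3 pairwise distinct vertices
-- x₀ … x_k.
Cycle : ∀ {n} → Graph n → Set
Cycle {n} G = Σ (Fin n) λ x → Σ (List (Fin n)) λ vs → Σ (Fin n) λ y →
  Walk G x y (x ∷ vs) × T (adj G y x) × Unique (x ∷ vs) × (2 ≤ length vs)

Acyclic : ∀ {n} → Graph n → Set
Acyclic G = Cycle G → Data.Empty.⊥
  where import Data.Empty

IsTree : ∀ {n} → Graph n → Set
IsTree {n} G = (1 ≤ n) × Connected G × Acyclic G

reach : ∀ {n} → Graph n → ℕ → Fin n → Fin n → Bool
reach {n} G zero    u w = does (u ≟ᶠ w)
reach {n} G (suc k) u w =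
  reach G k u w ∨ any (λ x → adj G u x ∧ reach G k x w) (allFin n)

-- least k in [i, i+fuel) with reach G k u w; returns i+fuel if none
search : ∀ {n} → Graph n → Fin n → Fin n → ℕ → ℕ → ℕ
search G u w i zero = i
search G u w i (suc fuel) with reach G i u w
... | true  = i
... | false = search G u w (suc i) fuel

-- Shortest-path distance.  In a connected graph on n vertices every distance
-- is < n, so a bounded search over 0 … n-1 computes it exactly.
dist : ∀ {n} → Graph n → Fin n → Fin n → ℕ
dist {n} G u w = search G u w 0 n

nClose : ∀ {n} → Graph n → Fin n → Fin n → ℕ
nClose {n} G u v = length (filter (λ w → dist G w u Data.Nat.<? dist G w v) (allFin n))
  where import Data.Nat

edges : ∀ {n} → Graph n → List (Fin n × Fin n)
edges {n} G = concatMap (λ u → map (λ v → (u , v))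
                 (filter (λ v → Data.Bool._≟_ (adj G u v ∧ ⌊ toℕ u Data.Nat.<? toℕ v ⌋) true) (allFin n)))
                 (allFin n)
  where import Data.Nat; import Data.Bool

Mo : ∀ {n} → Graph n → ℕ
Mo G = sum (map (λ e → ∣ nClose G (Data.Product.proj₁ e) (Data.Product.proj₂ e)
                         - nClose G (Data.Product.proj₂ e) (Data.Product.proj₁ e) ∣) (edges G))
  where import Data.Product

{-# OPTIONS --safe #-}
-- Root a tree at a vertex. Every vertex u other than the root is joined to its parent p, and n_u + n_p = n
-- because no vertex is equidistant from the two ends of an edge (their depths below it differ). So each term
-- |n_u - n_p| has the parity of n, and Mo is congruent to (n - 1) n, which is even.
--
-- Conversely, take the caterpillar with spine 1 - 0 - 2 carrying a, b and c legs and s = a + b + c.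
-- An end u of an edge whose other neighbours are leaves has n_u = deg u, so each leg contributes s + 1 and, when
-- a and c differ by at most one, the spine contributes 2 (b + 1): Mo = s (s + 1) + 2 (b + 1). Since every m
-- is s (s + 1) / 2 + b with b ≤ s, these caterpillars realise every positive even number; one vertex gives 0.
module Submission where

open import Defs hiding (sym)
open import Data.Nat.Base as ℕ
  using (ℕ; zero; suc; _+_; _*_; _∸_; _≤_; _<_; z≤n; s≤s; s≤s⁻¹; ⌊_/2⌋; ⌈_/2⌉; >-nonZero⁻¹)
open import Data.Nat using (_≤?_; _<?_; _≟_)
open import Data.Nat.Properties
open import Data.Nat.Tactic.RingSolver using (solve-∀)
open import Data.Nat.Divisibility using (_∣_; divides; _∣0; ∣m∣n⇒∣m+n; ∣m+n∣m⇒∣n)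
open import Data.Nat.ListAction using (sum)
open import Data.Nat.ListAction.Properties using (sum-++)
open import Algebra.Properties.CommutativeMonoid.Sum +-0-commutativeMonoid
  using (sum-syntax; sum-cong-≗; ∑-distrib-+; ∑-comm) renaming (sum to ∑)
open import Data.Bool using (Bool; true; false; T; _∧_; if_then_else_) renaming (_≟_ to _≟ᵇ_)
open import Data.Bool.Properties using (T-∨; T-∧; T-≡)
open import Data.Fin using (Fin; toℕ; fromℕ<) renaming (zero to fzero; suc to fsuc)
open import Data.Fin.Properties using (toℕ-injective; toℕ<n; toℕ-fromℕ<; pigeonhole; nonZeroIndex)
  renaming (_≟_ to _≟ᶠ_; suc-injective to fsuc-injective)
open import Data.List using (List; []; _∷_; length; map; filter; allFin; tabulate; concatMap; _++_)
open import Data.List.Properties using (map-++; map-∘; length-++)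
open import Data.List.Relation.Unary.All as All using (All; []; _∷_)
import Data.List.Relation.Unary.All.Properties as All
open import Data.List.Relation.Unary.AllPairs using ([]; _∷_)
import Data.List.Relation.Unary.AllPairs.Properties as AllPairs
open import Data.List.Relation.Unary.Unique.Propositional using (Unique)
open import Data.List.Relation.Unary.Any using (satisfied; here; there)
open import Data.List.Relation.Unary.Any.Properties using (any⁺; any⁻)
open import Data.List.Membership.Propositional using (_∈_; lose)
open import Data.List.Membership.Propositional.Properties using (∈-allFin)
open import Data.Product using (Σ; _×_; ∃; ∃₂; _,_; proj₁; proj₂; map₁; map₂)
open import Data.Sum using (_⊎_; inj₁; inj₂; [_,_]; swap)
open import Data.Empty using (⊥; ⊥-elim)
open import Function using (_∘_; id)
open import Function.Bundles using (_⇔_; mk⇔; Equivalence)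
open import Relation.Nullary using (¬_; Dec; yes; no; does)
open import Relation.Nullary.Decidable using (⌊_⌋; T?; ¬?; isYes≗does; dec-true; dec-false; _×-dec_; _⊎-dec_)
open import Relation.Binary.PropositionalEquality hiding ([_])
open import Relation.Binary.Definitions using (tri<; tri≈; tri>)

open Equivalence using (to; from)

indicator : Bool → ℕ
indicator true  = 1
indicator false = 0

does≡ : ∀ {A : Set} (a? : Dec A) {b} → (A → T b) → (T b → A) → does a? ≡ b
does≡ (yes a) {true}  _   _   = refl
does≡ (yes a) {false} a→b _   = ⊥-elim (a→b a)
does≡ (no ¬a) {true}  _   b→a = ⊥-elim (¬a (b→a _))
does≡ (no ¬a) {false} _   _   = refl

T-does⁻ : ∀ {A : Set} (a? : Dec A) → T (does a?) → A
T-does⁻ (yes a) _ = a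

T-does⁺ : ∀ {A : Set} (a? : Dec A) → A → T (does a?)
T-does⁺ (yes _)  _ = _
T-does⁺ (no ¬a) a = ¬a a

does-⇔ : ∀ {A B : Set} (a? : Dec A) (b? : Dec B) → (A → B) → (B → A) → does a? ≡ does b?
does-⇔ a? b? a→b b→a = does≡ a? (T-does⁺ b? ∘ a→b) (b→a ∘ T-does⁻ b?)

indicator-⊎ : ∀ {A B : Set} (a? : Dec A) (b? : Dec B) → (A → B → ⊥) →
  indicator (does (a? ⊎-dec b?)) ≡ indicator (does a?) + indicator (does b?)
indicator-⊎ (yes a) (yes b) disjoint = ⊥-elim (disjoint a b)
indicator-⊎ (yes _) (no _)  _        = refl
indicator-⊎ (no _)  (yes _) _        = refl
indicator-⊎ (no _)  (no _)  _        = refl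

indicator-< : ∀ {i j} → i ≢ j → indicator (does (i <? j)) + indicator (does (j <? i)) ≡ 1
indicator-< {i} {j} i≢j with <-cmp i j
... | tri< i<j _ _ rewrite dec-true (i <? j) i<j | dec-false (j <? i) (<-asym i<j) = refl
... | tri≈ _ i≡j _ = ⊥-elim (i≢j i≡j)
... | tri> _ _ j<i rewrite dec-false (i <? j) (<-asym j<i) | dec-true (j <? i) j<i = refl

isYes-true : ∀ {A : Set} (a? : Dec A) → A → ⌊ a? ⌋ ≡ true
isYes-true a? a = trans (isYes≗does a?) (dec-true a? a)

isYes-false : ∀ {A : Set} (a? : Dec A) → ¬ A → ⌊ a? ⌋ ≡ false
isYes-false a? ¬a = trans (isYes≗does a?) (dec-false a? ¬a)

if-<-pair : ∀ (a : Bool) {i j} x → (T a → i ≢ j) →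
  (if a ∧ ⌊ i <? j ⌋ then x else 0) + (if a ∧ ⌊ j <? i ⌋ then x else 0) ≡ (if a then x else 0)
if-<-pair false x _ = refl
if-<-pair true {i} {j} x i≢j with <-cmp i j
... | tri< i<j _ _ rewrite isYes-true (i <? j) i<j | isYes-false (j <? i) (<-asym i<j) = +-identityʳ x
... | tri≈ _ i≡j _ = ⊥-elim (i≢j _ i≡j)
... | tri> _ _ j<i rewrite isYes-false (i <? j) (<-asym j<i) | isYes-true (j <? i) j<i = refl

∑-zero : ∀ {n} (f : Fin n → ℕ) → (∀ i → f i ≡ 0) → ∑ f ≡ 0
∑-zero {zero}  f f≗0 = refl
∑-zero {suc n} f f≗0 = cong₂ _+_ (f≗0 fzero) (∑-zero (f ∘ fsuc) (f≗0 ∘ fsuc))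

∑-const : ∀ n k → ∑[ i < n ] k ≡ n * k
∑-const zero    k = refl
∑-const (suc n) k = cong (k +_) (∑-const n k)

∑-single : ∀ {n} (f : Fin n → ℕ) i → (∀ j → j ≢ i → f j ≡ 0) → ∑ f ≡ f i
∑-single f fzero    others≡0 =
  trans (cong (f fzero +_) (∑-zero (f ∘ fsuc) (λ j → others≡0 (fsuc j) λ ()))) (+-identityʳ _)
∑-single f (fsuc i) others≡0 =
  cong₂ _+_ (others≡0 fzero λ ()) (∑-single (f ∘ fsuc) i (λ j j≢i → others≡0 (fsuc j) (j≢i ∘ fsuc-injective)))

∑-indicator-≡ : ∀ {n} (u : Fin n) → ∑[ w < n ] indicator (does (w ≟ᶠ u)) ≡ 1
∑-indicator-≡ u = trans (∑-single _ u (λ w w≢u → cong indicator (dec-false (w ≟ᶠ u) w≢u)))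
                        (cong indicator (dec-true (u ≟ᶠ u) refl))

∑-∣ : ∀ {n} d (f : Fin n → ℕ) → (∀ i → d ∣ f i) → d ∣ ∑ f
∑-∣ {zero}  d f d∣f = d ∣0
∑-∣ {suc n} d f d∣f = ∣m∣n⇒∣m+n (d∣f fzero) (∑-∣ d (f ∘ fsuc) (d∣f ∘ fsuc))

∑-toℕ-+ : ∀ m k (h : ℕ → ℕ) →
  ∑[ i < m + k ] h (toℕ i) ≡ ∑[ i < m ] h (toℕ i) + ∑[ i < k ] h (m + toℕ i)
∑-toℕ-+ zero    k h = refl
∑-toℕ-+ (suc m) k h = trans (cong (h 0 +_) (∑-toℕ-+ m k (h ∘ suc))) (sym (+-assoc (h 0) _ _))

∑∑-cong-symmetric : ∀ {n} (f g : Fin n → Fin n → ℕ) → (∀ u v → f u v + f v u ≡ g u v + g v u) →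
  ∑[ u < n ] ∑[ v < n ] f u v ≡ ∑[ u < n ] ∑[ v < n ] g u v
∑∑-cong-symmetric {n} f g f≈g = *-cancelˡ-≡ _ _ 2 (begin
    2 * S f                                     ≡⟨ twice f ⟩
    ∑[ u < n ] ∑[ v < n ] (f u v + f v u)       ≡⟨ sum-cong-≗ (λ u → sum-cong-≗ (f≈g u)) ⟩
    ∑[ u < n ] ∑[ v < n ] (g u v + g v u)       ≡⟨ twice g ⟨
    2 * S g                                     ∎)
  where
  open ≡-Reasoning
  S : (Fin n → Fin n → ℕ) → ℕ
  S h = ∑[ u < n ] ∑[ v < n ] h u v
  twice : ∀ h → 2 * S h ≡ ∑[ u < n ] ∑[ v < n ] (h u v + h v u)
  twice h = begin
    S h + (S h + 0)                                   ≡⟨ cong (S h +_) (+-identityʳ (S h)) ⟩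
    S h + S h                                         ≡⟨ cong (S h +_) (∑-comm h) ⟩
    S h + ∑[ v < n ] ∑[ u < n ] h u v                 ≡⟨ ∑-distrib-+ (λ u → ∑[ v < n ] h u v) _ ⟨
    ∑[ u < n ] (∑[ v < n ] h u v + ∑[ v < n ] h v u)
      ≡⟨ sum-cong-≗ (λ u → ∑-distrib-+ (h u) (λ v → h v u)) ⟨
    ∑[ u < n ] ∑[ v < n ] (h u v + h v u)             ∎

sum-map-tabulate : ∀ {A : Set} n (g : Fin n → A) (f : A → ℕ) → sum (map f (tabulate g)) ≡ ∑[ i < n ] f (g i)
sum-map-tabulate zero    g f = refl
sum-map-tabulate (suc n) g f = cong (f (g fzero) +_) (sum-map-tabulate n (g ∘ fsuc) f)

sum-map-allFin : ∀ n (f : Fin n → ℕ) → sum (map f (allFin n)) ≡ ∑ f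
sum-map-allFin n = sum-map-tabulate n id

sum-map-filter : ∀ {A : Set} {P : A → Set} (P? : ∀ x → Dec (P x)) (f : A → ℕ) xs →
  sum (map f (filter P? xs)) ≡ sum (map (λ x → if does (P? x) then f x else 0) xs)
sum-map-filter P? f []       = refl
sum-map-filter P? f (x ∷ xs) with does (P? x)
... | true  = cong (f x +_) (sum-map-filter P? f xs)
... | false = sum-map-filter P? f xs

length-filter-indicator : ∀ {A : Set} {P : A → Set} (P? : ∀ x → Dec (P x)) xs →
  length (filter P? xs) ≡ sum (map (λ x → indicator (does (P? x))) xs)
length-filter-indicator P? []       = refl
length-filter-indicator P? (x ∷ xs) with does (P? x)
... | true  = cong suc (length-filter-indicator P? xs)
... | false = length-filter-indicator P? xs

sum-map-concatMap : ∀ {A B : Set} (f : B → ℕ) (g : A → List B) xs →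
  sum (map f (concatMap g xs)) ≡ sum (map (λ x → sum (map f (g x))) xs)
sum-map-concatMap f g []       = refl
sum-map-concatMap f g (x ∷ xs) = begin
  sum (map f (g x ++ concatMap g xs))            ≡⟨ cong sum (map-++ f (g x) (concatMap g xs)) ⟩
  sum (map f (g x) ++ map f (concatMap g xs))    ≡⟨ sum-++ (map f (g x)) _ ⟩
  sum (map f (g x)) + sum (map f (concatMap g xs)) ≡⟨ cong (sum (map f (g x)) +_) (sum-map-concatMap f g xs) ⟩
  sum (map f (g x)) + sum (map (λ x → sum (map f (g x))) xs) ∎
  where open ≡-Reasoning

∣-∣≡ℕ∣-∣ : ∀ m n → ∣ m - n ∣ ≡ ℕ.∣ m - n ∣
∣-∣≡ℕ∣-∣ zero    n       = refl
∣-∣≡ℕ∣-∣ (suc m) zero    = refl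
∣-∣≡ℕ∣-∣ (suc m) (suc n) = ∣-∣≡ℕ∣-∣ m n

∣-∣-sym : ∀ m n → ∣ m - n ∣ ≡ ∣ n - m ∣
∣-∣-sym m n = trans (∣-∣≡ℕ∣-∣ m n) (trans (∣-∣-comm m n) (sym (∣-∣≡ℕ∣-∣ n m)))

2∣∣m-n∣+[m+n] : ∀ m n → 2 ∣ ∣ m - n ∣ + (m + n)
2∣∣m-n∣+[m+n] zero    n       = divides n (sym (trans (*-comm n 2) (cong (n +_) (+-identityʳ n))))
2∣∣m-n∣+[m+n] (suc m) zero    = divides (suc m) (*-comm 2 (suc m))
2∣∣m-n∣+[m+n] (suc m) (suc n) =
  subst (2 ∣_) (sym two+) (∣m∣n⇒∣m+n (divides 1 refl) (2∣∣m-n∣+[m+n] m n))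
  where
  two+ : ∣ m - n ∣ + (suc m + suc n) ≡ 2 + (∣ m - n ∣ + (m + n))
  two+ = trans (+-suc ∣ m - n ∣ (m + suc n)) (cong suc (trans (cong (∣ m - n ∣ +_) (+-suc m n)) (+-suc ∣ m - n ∣ (m + n))))

triangle : ℕ → ℕ
triangle zero    = 0
triangle (suc s) = suc s + triangle s

triangle-double : ∀ s → triangle s + triangle s ≡ s * suc s
triangle-double zero    = refl
triangle-double (suc s) = begin
  (suc s + t) + (suc s + t)     ≡⟨ regroup (suc s) t ⟩
  (t + t) + 2 * suc s           ≡⟨ cong (_+ 2 * suc s) (triangle-double s) ⟩
  s * suc s + 2 * suc s         ≡⟨ expand s ⟩
  suc s * suc (suc s)           ∎
  where
  open ≡-Reasoning
  t = triangle s
  regroup : ∀ a t → (a + t) + (a + t) ≡ (t + t) + 2 * a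
  regroup = solve-∀
  expand : ∀ s → s * suc s + 2 * suc s ≡ suc s * suc (suc s)
  expand = solve-∀

2∣n*[1+n] : ∀ s → 2 ∣ s * suc s
2∣n*[1+n] s = divides (triangle s) (trans (sym (triangle-double s)) (twice≡*2 (triangle s)))
  where
  twice≡*2 : ∀ t → t + t ≡ t * 2
  twice≡*2 = solve-∀

triangular-decomposition : ∀ m → ∃₂ λ s b → b ≤ s × triangle s + b ≡ m
triangular-decomposition zero    = 0 , 0 , z≤n , refl
triangular-decomposition (suc m) with triangular-decomposition m
... | s , b , b≤s , refl with m≤n⇒m<n∨m≡n b≤s
...   | inj₁ b<s  = s , suc b , b<s , +-suc (triangle s) b
...   | inj₂ refl = suc b , 0 , z≤n , trans (+-identityʳ _) (cong suc (+-comm b (triangle b)))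

⌈n/2⌉≤1+⌊n/2⌋ : ∀ t → ⌈ t /2⌉ ≤ suc ⌊ t /2⌋
⌈n/2⌉≤1+⌊n/2⌋ zero          = z≤n
⌈n/2⌉≤1+⌊n/2⌋ (suc zero)    = ≤-refl
⌈n/2⌉≤1+⌊n/2⌋ (suc (suc t)) = s≤s (⌈n/2⌉≤1+⌊n/2⌋ t)

adj⇒≢ : ∀ {n} (G : Graph n) {u v} → T (adj G u v) → u ≢ v
adj⇒≢ G {u} uv refl = subst T (Graph.irrefl G u) uv

adj-sym : ∀ {n} (G : Graph n) {u v} → T (adj G u v) → T (adj G v u)
adj-sym G {u} {v} = subst T (Graph.sym G u v)

degree : ∀ {n} → Graph n → Fin n → ℕ
degree {n} G u = ∑[ w < n ] indicator (adj G u w)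

walk-∷ʳ : ∀ {n} {G : Graph n} {u v t vs} → Walk G u v vs → T (adj G v t) → Walk G u t (vs ++ t ∷ [])
walk-∷ʳ (here u)     vt = step vt (here _)
walk-∷ʳ (step uw wv) vt = step uw (walk-∷ʳ wv vt)

walk-first : ∀ {n} {G : Graph n} {a b ls} → Walk G a b ls → a ∈ ls
walk-first (here _)   = here refl
walk-first (step _ _) = here refl

walk-last : ∀ {n} {G : Graph n} {a b ls} → Walk G a b ls → b ∈ ls
walk-last (here _)      = here refl
walk-last (step _ walk) = there (walk-last walk)

walk-++ : ∀ {n} {G : Graph n} {a b c ls ms} → Walk G a b ls → Walk G b c ms → ∃ (Walk G a c)
walk-++ (here _)       walk′ = _ , walk′
walk-++ (step aw walk) walk′ with walk-++ walk walk′
... | _ , walk″ = _ , step aw walk″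

walk-reverse : ∀ {n} {G : Graph n} {a b ls} → Walk G a b ls → ∃ (Walk G b a)
walk-reverse (here a) = _ , here a
walk-reverse {G = G} (step aw walk) with walk-reverse walk
... | _ , walk″ = _ , walk-∷ʳ walk″ (adj-sym G aw)

walk-penultimate : ∀ {n} {G : Graph n} {a v b vs} → Walk G a b (a ∷ v ∷ vs) →
  ∃ λ p → p ∈ (a ∷ v ∷ vs) × T (adj G p b)
walk-penultimate (step ab (here _)) = _ , here refl , ab
walk-penultimate {G = G} (step _ (step vu (here _))) =
  map₂ (map₁ there) (walk-penultimate {G = G} (step vu (here _)))
walk-penultimate {G = G} (step _ (step vu (step uw walk))) =
  map₂ (map₁ there) (walk-penultimate {G = G} (step vu (step uw walk)))

-- Distances

module Distance {n} (G : Graph n) where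

  reach-0⇒≡ : ∀ {u w} → T (reach G 0 u w) → u ≡ w
  reach-0⇒≡ {u} {w} uw with u ≟ᶠ w
  ... | yes u≡w = u≡w

  reach-0-refl : ∀ u → T (reach G 0 u u)
  reach-0-refl u with u ≟ᶠ u
  ... | yes _   = _
  ... | no  u≢u = u≢u refl

  reach-suc : ∀ k {u w} → T (reach G k u w) → T (reach G (suc k) u w)
  reach-suc k = from T-∨ ∘ inj₁

  reach-∷ : ∀ k {u x w} → T (adj G u x) → T (reach G k x w) → T (reach G (suc k) u w)
  reach-∷ k {x = x} ux xw = from T-∨ (inj₂ (any⁺ _ (lose (∈-allFin x) (from T-∧ (ux , xw)))))

  reach-suc⁻ : ∀ k {u w} → T (reach G (suc k) u w) →
    T (reach G k u w) ⊎ ∃ λ x → T (adj G u x) × T (reach G k x w)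
  reach-suc⁻ k uw with to T-∨ uw
  ... | inj₁ uw′ = inj₁ uw′
  ... | inj₂ via = inj₂ (map₂ (to T-∧) (satisfied (any⁻ _ (allFin n) via)))

  reach-∷ʳ : ∀ k {u x w} → T (reach G k u x) → T (adj G x w) → T (reach G (suc k) u w)
  reach-∷ʳ zero {u} {x} {w} ux xw with reach-0⇒≡ {u} {x} ux
  ... | refl = reach-∷ 0 xw (reach-0-refl w)
  reach-∷ʳ (suc k) ux xw with reach-suc⁻ k ux
  ... | inj₁ ux′             = reach-suc (suc k) (reach-∷ʳ k ux′ xw)
  ... | inj₂ (y , uy , yx) = reach-∷ (suc k) uy (reach-∷ʳ k yx xw)

  reach-sym : ∀ k {u w} → T (reach G k u w) → T (reach G k w u)
  reach-sym zero {u} {w} uw with reach-0⇒≡ {u} {w} uw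
  ... | refl = uw
  reach-sym (suc k) uw with reach-suc⁻ k uw
  ... | inj₁ uw′             = reach-suc k (reach-sym k uw′)
  ... | inj₂ (x , ux , xw) = reach-∷ʳ k (reach-sym k xw) (adj-sym G ux)

  search-≤ : ∀ u w i f → search G u w i f ≤ i + f
  search-≤ u w i zero = ≤-reflexive (sym (+-identityʳ i))
  search-≤ u w i (suc f) with reach G i u w
  ... | true  = m≤m+n i (suc f)
  ... | false = ≤-trans (search-≤ u w (suc i) f) (≤-reflexive (sym (+-suc i f)))

  search-reach : ∀ u w i f → search G u w i f < i + f → T (reach G (search G u w i f) u w)
  search-reach u w i zero    s<i+0 = ⊥-elim (<-irrefl (sym (+-identityʳ i)) s<i+0)
  search-reach u w i (suc f) s<i+f with reach G i u w in found
  ... | true  = subst T (sym found) _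
  ... | false = search-reach u w (suc i) f (≤-trans s<i+f (≤-reflexive (+-suc i f)))

  search-minimal : ∀ u w i f j → i ≤ j → j < search G u w i f → ¬ T (reach G j u w)
  search-minimal u w i zero    j i≤j j<i = ⊥-elim (<-irrefl refl (≤-trans j<i i≤j))
  search-minimal u w i (suc f) j i≤j j<s with reach G i u w in found
  ... | true  = ⊥-elim (<-irrefl refl (≤-trans j<s i≤j))
  ... | false with m≤n⇒m<n∨m≡n i≤j
  ...   | inj₁ i<j  = search-minimal u w (suc i) f j i<j j<s
  ...   | inj₂ refl = subst T found

  dist≤n : ∀ u w → dist G u w ≤ n
  dist≤n u w = search-≤ u w 0 n

  dist<n⇒reach : ∀ {u w} → dist G u w < n → T (reach G (dist G u w) u w)
  dist<n⇒reach = search-reach _ _ 0 n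

  reach⇒dist≤ : ∀ k {u w} → T (reach G k u w) → dist G u w ≤ k
  reach⇒dist≤ k uw = ≮⇒≥ (λ k<d → search-minimal _ _ 0 n k z≤n k<d uw)

  dist-sym-≤ : ∀ u w → dist G w u ≤ dist G u w
  dist-sym-≤ u w with m≤n⇒m<n∨m≡n (dist≤n u w)
  ... | inj₁ d<n = reach⇒dist≤ (dist G u w) (reach-sym (dist G u w) (dist<n⇒reach d<n))
  ... | inj₂ d≡n = ≤-trans (dist≤n w u) (≤-reflexive (sym d≡n))

  dist-sym : ∀ u w → dist G u w ≡ dist G w u
  dist-sym u w = ≤-antisym (dist-sym-≤ w u) (dist-sym-≤ u w)

  dist-refl : ∀ u → dist G u u ≡ 0
  dist-refl u = n≤0⇒n≡0 (reach⇒dist≤ 0 (reach-0-refl u))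

  dist≡0⇒≡ : ∀ {u w} → dist G u w ≡ 0 → u ≡ w
  dist≡0⇒≡ {u} d≡0 = reach-0⇒≡ (subst (λ k → T (reach G k _ _)) d≡0
    (dist<n⇒reach (subst (_< n) (sym d≡0) (>-nonZero⁻¹ n {{nonZeroIndex u}}))))

  dist-adj : ∀ {x y} r → T (adj G x y) → dist G x r ≤ suc (dist G y r)
  dist-adj {x} {y} r xy with m≤n⇒m<n∨m≡n (dist≤n y r)
  ... | inj₁ d<n = reach⇒dist≤ (suc (dist G y r)) (reach-∷ (dist G y r) xy (dist<n⇒reach d<n))
  ... | inj₂ d≡n = ≤-trans (dist≤n x r) (≤-trans (≤-reflexive (sym d≡n)) (n≤1+n _))

  dist-pred : ∀ {x r} → x ≢ r → dist G x r < n → ∃ λ y → T (adj G x y) × suc (dist G y r) ≡ dist G x r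
  dist-pred {x} {r} x≢r d<n with dist G x r in d≡ | dist<n⇒reach d<n
  ... | zero  | _ = ⊥-elim (x≢r (dist≡0⇒≡ d≡))
  ... | suc k | xr with reach-suc⁻ k xr
  ...   | inj₁ xr′ = ⊥-elim (<-irrefl refl (≤-trans (≤-reflexive (sym d≡)) (reach⇒dist≤ k xr′)))
  ...   | inj₂ (y , xy , yr) =
          y , xy , cong suc (≤-antisym (reach⇒dist≤ k yr) (s≤s⁻¹ (subst (_≤ suc (dist G y r)) d≡ (dist-adj r xy))))

module Rooted {n} (G : Graph n) (connected : Connected G) (r : Fin n) where
  open Distance G

  depth : Fin n → ℕ
  depth x = dist G x r

  depth-root : depth r ≡ 0
  depth-root = dist-refl r

  depth≡0⇒root : ∀ {x} → depth x ≡ 0 → x ≡ r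
  depth≡0⇒root = dist≡0⇒≡

  depth-adj : ∀ {x y} → T (adj G x y) → depth x ≤ suc (depth y)
  depth-adj = dist-adj r

  depth-lower-neighbour : ∀ {x y} → T (adj G x y) → depth y < depth x → suc (depth y) ≡ depth x
  depth-lower-neighbour x∼y dy<dx = ≤-antisym dy<dx (depth-adj x∼y)

  smaller-depth-occurs : ∀ m j v → depth v ≡ m + j → depth v < n → ∃ λ u → depth u ≡ j
  smaller-depth-occurs zero    j v dv≡j _ = v , dv≡j
  smaller-depth-occurs (suc m) j v dv≡ dv<n with dist-pred v≢r dv<n
    where
    v≢r : v ≢ r
    v≢r refl = 0≢1+n (trans (sym depth-root) dv≡)
  ... | y , _ , dy≡ =
    smaller-depth-occurs m j y (suc-injective (trans dy≡ dv≡)) (<-trans (n<1+n _) (subst (_< n) (sym dy≡) dv<n))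

  walk-crosses-depth-n : ∀ {a b vs} → Walk G a b vs → depth a ≡ n → depth b < n →
    ∃₂ λ p q → T (adj G p q) × depth p ≡ n × depth q < n
  walk-crosses-depth-n (here _) da≡n da<n = ⊥-elim (<-irrefl da≡n da<n)
  walk-crosses-depth-n {a} (step {w = w} aw walk) da≡n db<n with depth w <? n
  ... | yes dw<n = a , w , aw , da≡n , dw<n
  ... | no  dw≮n = walk-crosses-depth-n walk (≤-antisym (dist≤n w r) (≮⇒≥ dw≮n)) db<n

  vertex-at-each-depth : ∀ {x q} → depth x ≡ n → n ≤ suc (depth q) → depth q < n →
    (i : Fin (suc n)) → ∃ λ u → depth u ≡ toℕ i
  vertex-at-each-depth {x} {q} dx≡n n≤1+dq dq<n i with toℕ i <? n
  ... | yes i<n =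
    smaller-depth-occurs (depth q ∸ toℕ i) (toℕ i) q (sym (m∸n+n≡m (s≤s⁻¹ (≤-trans i<n n≤1+dq)))) dq<n
  ... | no  i≮n = x , trans dx≡n (≤-antisym (≮⇒≥ i≮n) (s≤s⁻¹ (toℕ<n i)))

  depths-not-all-occur : ¬ ((i : Fin (suc n)) → ∃ λ u → depth u ≡ toℕ i)
  depths-not-all-occur at with pigeonhole (n<1+n n) (proj₁ ∘ at)
  ... | i , j , i<j , same =
    <-irrefl (trans (sym (proj₂ (at i))) (trans (cong depth same) (proj₂ (at j)))) i<j

  -- dist yields n when its bounded search fails. That cannot happen here: along a walk from x to r some vertex
  -- would have depth n - 1, and then all the n + 1 depths 0, …, n would occur among the n vertices.
  depth≢n : ∀ x → depth x ≢ n
  depth≢n x dx≡n with walk-crosses-depth-n (proj₂ (connected x r)) dx≡n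
                        (subst (_< n) (sym depth-root) (>-nonZero⁻¹ n {{nonZeroIndex x}}))
  ... | p , q , pq , dp≡n , dq<n =
        depths-not-all-occur (vertex-at-each-depth dx≡n (subst (_≤ suc (depth q)) dp≡n (depth-adj pq)) dq<n)

  depth<n : ∀ x → depth x < n
  depth<n x = ≤∧≢⇒< (dist≤n x r) (depth≢n x)

  parent : ∀ {x} → x ≢ r → ∃ λ y → T (adj G x y) × suc (depth y) ≡ depth x
  parent {x} x≢r = dist-pred x≢r (depth<n x)

module RootedTree {n} (G : Graph n) (connected : Connected G) (acyclic : Acyclic G) (r : Fin n) where
  open Rooted G connected r public

  ShallowPath : ℕ → Fin n → Fin n → Set
  ShallowPath k a b = ∃ λ ps →
    Walk G a b (a ∷ ps) × Unique (a ∷ ps) × All (λ z → depth z ≤ k) (a ∷ ps) × 2 ≤ length ps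

  private
    deeper-≢ : ∀ {k x z} → depth x ≡ suc k → depth z ≤ k → x ≢ z
    deeper-≢ dx≡ dz≤k refl = <-irrefl refl (≤-trans (≤-reflexive (sym dx≡)) dz≤k)

    non-root : ∀ {k x} → depth x ≡ suc k → x ≢ r
    non-root dx≡ refl = 0≢1+n (trans (sym depth-root) dx≡)

  -- Climb from a and b in parallel until the two climbs meet.
  shallowPath : ∀ k {a b} → a ≢ b → depth a ≡ k → depth b ≡ k → ShallowPath k a b
  shallowPath zero    a≢b da≡0 db≡0 = ⊥-elim (a≢b (trans (depth≡0⇒root da≡0) (sym (depth≡0⇒root db≡0))))
  shallowPath (suc k) {a} {b} a≢b da≡ db≡ with parent (non-root da≡) | parent (non-root db≡)
  ... | pa , a∼pa , dpa≡ | pb , b∼pb , dpb≡ with pa ≟ᶠ pb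
  ...   | yes refl = (pa ∷ b ∷ []) , walk , unique , shallow , ≤-refl
    where
    dpa : depth pa ≡ k
    dpa = suc-injective (trans dpa≡ da≡)
    walk : Walk G a b (a ∷ pa ∷ b ∷ [])
    walk = step a∼pa (step (adj-sym G b∼pb) (here b))
    unique : Unique (a ∷ pa ∷ b ∷ [])
    unique = (deeper-≢ da≡ (≤-reflexive dpa) ∷ a≢b ∷ []) ∷
             ((deeper-≢ db≡ (≤-reflexive dpa) ∘ sym) ∷ []) ∷ [] ∷ []
    shallow : All (λ z → depth z ≤ suc k) (a ∷ pa ∷ b ∷ [])
    shallow = ≤-reflexive da≡ ∷ ≤-trans (≤-reflexive dpa) (n≤1+n k) ∷ ≤-reflexive db≡ ∷ []
  ...   | no pa≢pb with shallowPath k pa≢pb (suc-injective (trans dpa≡ da≡)) (suc-injective (trans dpb≡ db≡))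
  ...     | qs , walk , unique , shallow , 2≤|qs| = (pa ∷ qs) ++ b ∷ [] , walk′ , unique′ , shallow′ , 2≤length
    where
    walk′ = step a∼pa (walk-∷ʳ walk (adj-sym G b∼pb))
    unique′ = All.++⁺ (All.map (deeper-≢ da≡) shallow) (a≢b ∷ []) ∷
              AllPairs.++⁺ unique ([] ∷ []) (All.map (λ dz≤k → (deeper-≢ db≡ dz≤k ∘ sym) ∷ []) shallow)
    shallow′ = ≤-reflexive da≡ ∷
               All.++⁺ (All.map (λ dz≤k → ≤-trans dz≤k (n≤1+n k)) shallow) (≤-reflexive db≡ ∷ [])
    2≤length = ≤-trans (≤-trans 2≤|qs| (n≤1+n _)) (≤-trans (m≤m+n _ 1) (≤-reflexive (sym (length-++ (pa ∷ qs)))))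

  adj⇒depth≢ : ∀ {u v} → T (adj G u v) → depth u ≢ depth v
  adj⇒depth≢ {u} {v} u∼v du≡dv with shallowPath (depth u) (adj⇒≢ G u∼v) refl (sym du≡dv)
  ... | ps , walk , unique , _ , 2≤|ps| = acyclic (u , ps , v , walk , adj-sym G u∼v , unique , 2≤|ps|)

  lower-neighbour-unique : ∀ {x a b} → T (adj G x a) → T (adj G x b) →
    depth a < depth x → depth b < depth x → a ≡ b
  lower-neighbour-unique {x} {a} {b} x∼a x∼b da<dx db<dx with a ≟ᶠ b
  ... | yes a≡b = a≡b
  ... | no  a≢b with shallowPath (depth a) a≢b refl
                       (suc-injective (trans (depth-lower-neighbour x∼b db<dx) (sym (depth-lower-neighbour x∼a da<dx))))
  ...   | ps , walk , unique , shallow , 2≤|ps| =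
          ⊥-elim (acyclic (x , a ∷ ps , b , step x∼a walk , adj-sym G x∼b ,
                            All.map (λ dz≤da → λ { refl → <-irrefl refl (≤-trans da<dx dz≤da) }) shallow ∷ unique ,
                            s≤s (≤-trans (s≤s z≤n) 2≤|ps|)))

  -- The parent of u is a neighbour that is not a leaf hanging from u.
  others-leaves⇒above : ∀ {u v} → u ≢ r → T (adj G u v) →
    (∀ q → T (adj G u q) → q ≢ v → q ≢ r × (∀ z → T (adj G q z) → z ≡ u)) → depth v < depth u
  others-leaves⇒above {u} {v} u≢r u∼v others with parent u≢r
  ... | q , u∼q , dq≡du with q ≟ᶠ v
  ...   | yes refl = ≤-reflexive dq≡du
  ...   | no  q≢v with others q u∼q q≢v
  ...     | q≢r , q-leaf with parent q≢r
  ...       | z , q∼z , dz≡dq with q-leaf z q∼z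
  ...         | refl = ⊥-elim (<-asym (≤-reflexive dz≡dq) (≤-reflexive dq≡du))

-- The Mostar index

module Mostar {n} (G : Graph n) where

  contribution : Fin n → Fin n → ℕ
  contribution u v = ∣ nClose G u v - nClose G v u ∣

  contribution-sym : ∀ u v → contribution u v ≡ contribution v u
  contribution-sym u v = ∣-∣-sym (nClose G u v) (nClose G v u)

  nClose-as-∑ : ∀ u v → nClose G u v ≡ ∑[ w < n ] indicator (does (dist G w u <? dist G w v))
  nClose-as-∑ u v = trans (length-filter-indicator (λ w → dist G w u <? dist G w v) (allFin n)) (sum-map-allFin n _)

  Mo-as-∑∑ : Mo G ≡ ∑[ u < n ] ∑[ v < n ] (if adj G u v ∧ ⌊ toℕ u <? toℕ v ⌋ then contribution u v else 0)
  Mo-as-∑∑ = begin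
    Mo G
      ≡⟨ sum-map-concatMap _ _ (allFin n) ⟩
    sum (map (λ u → sum (map edgeTerm (map (u ,_) (filter (isEdge u) (allFin n))))) (allFin n))
      ≡⟨ sum-map-allFin n _ ⟩
    ∑[ u < n ] sum (map edgeTerm (map (u ,_) (filter (isEdge u) (allFin n))))
      ≡⟨ sum-cong-≗ (λ u → cong sum (sym (map-∘ (filter (isEdge u) (allFin n))))) ⟩
    ∑[ u < n ] sum (map (edgeTerm ∘ (u ,_)) (filter (isEdge u) (allFin n)))
      ≡⟨ sum-cong-≗ (λ u → trans (sum-map-filter (isEdge u) _ (allFin n)) (sum-map-allFin n _)) ⟩
    ∑[ u < n ] ∑[ v < n ] (if does (isEdge u v) then contribution u v else 0)
      ≡⟨ sum-cong-≗ (λ u → sum-cong-≗ (λ v → cong (if_then contribution u v else 0) (does-≟-true _))) ⟩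
    ∑[ u < n ] ∑[ v < n ] (if adj G u v ∧ ⌊ toℕ u <? toℕ v ⌋ then contribution u v else 0) ∎
    where
    open ≡-Reasoning
    edgeTerm : Fin n × Fin n → ℕ
    edgeTerm (u , v) = contribution u v
    isEdge : ∀ u v → Dec (adj G u v ∧ ⌊ toℕ u <? toℕ v ⌋ ≡ true)
    isEdge u v = adj G u v ∧ ⌊ toℕ u <? toℕ v ⌋ ≟ᵇ true
    does-≟-true : ∀ b → does (b ≟ᵇ true) ≡ b
    does-≟-true true  = refl
    does-≟-true false = refl

  Mo-by-key : (key : Fin n → ℕ) → (∀ u v → T (adj G u v) → key u ≢ key v) →
    Mo G ≡ ∑[ u < n ] ∑[ v < n ] (if adj G u v ∧ ⌊ key v <? key u ⌋ then contribution u v else 0)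
  Mo-by-key key key-separates = trans Mo-as-∑∑ (∑∑-cong-symmetric _ _ λ u v →
    trans (by-index u v) (sym (by-key u v)))
    where
    by-index : ∀ u v →
      (if adj G u v ∧ ⌊ toℕ u <? toℕ v ⌋ then contribution u v else 0) +
      (if adj G v u ∧ ⌊ toℕ v <? toℕ u ⌋ then contribution v u else 0) ≡
      (if adj G u v then contribution u v else 0)
    by-index u v rewrite Graph.sym G v u | contribution-sym v u =
      if-<-pair (adj G u v) (contribution u v) (λ uv → adj⇒≢ G uv ∘ toℕ-injective)
    by-key : ∀ u v →
      (if adj G u v ∧ ⌊ key v <? key u ⌋ then contribution u v else 0) +
      (if adj G v u ∧ ⌊ key u <? key v ⌋ then contribution v u else 0) ≡
      (if adj G u v then contribution u v else 0)
    by-key u v rewrite Graph.sym G v u | contribution-sym v u =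
      if-<-pair (adj G u v) (contribution u v) (λ uv → key-separates u v uv ∘ sym)

module TreeMostar {n} (G : Graph n) (connected : Connected G) (acyclic : Acyclic G) where
  open Mostar G
  open Distance G

  -- No vertex w is equidistant from the ends of an edge, since their depths below w differ.
  nClose-complement : ∀ {u v} → T (adj G u v) → nClose G u v + nClose G v u ≡ n
  nClose-complement {u} {v} u∼v = begin
    nClose G u v + nClose G v u
      ≡⟨ cong₂ _+_ (nClose-as-∑ u v) (nClose-as-∑ v u) ⟩
    ∑[ w < n ] indicator (does (dist G w u <? dist G w v)) + ∑[ w < n ] indicator (does (dist G w v <? dist G w u))
      ≡⟨ ∑-distrib-+ (λ w → indicator (does (dist G w u <? dist G w v))) _ ⟨
    ∑[ w < n ] (indicator (does (dist G w u <? dist G w v)) + indicator (does (dist G w v <? dist G w u)))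
      ≡⟨ sum-cong-≗ (λ w → indicator-< (not-equidistant w)) ⟩
    ∑[ w < n ] 1
      ≡⟨ trans (∑-const n 1) (*-identityʳ n) ⟩
    n ∎
    where
    open ≡-Reasoning
    not-equidistant : ∀ w → dist G w u ≢ dist G w v
    not-equidistant w eq = RootedTree.adj⇒depth≢ G connected acyclic w u∼v
      (trans (dist-sym u w) (trans eq (dist-sym w v)))

  OtherNeighboursAreLeaves : Fin n → Fin n → Set
  OtherNeighboursAreLeaves u v = ∀ q → T (adj G u q) → q ≢ v → ∀ z → T (adj G q z) → z ≡ u

  module _ {u v} (u∼v : T (adj G u v)) (leaves : OtherNeighboursAreLeaves u v) where

    closer-to-u⇔ : ∀ w → dist G w u < dist G w v ⇔ (w ≡ u ⊎ (T (adj G u w) × w ≢ v))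
    closer-to-u⇔ w = mk⇔ closer⇒ ⇐closer
      where
      open RootedTree G connected acyclic w
      ⇐closer : w ≡ u ⊎ (T (adj G u w) × w ≢ v) → dist G w u < dist G w v
      ⇐closer (inj₁ refl) = subst (_< dist G w v) (sym (dist-refl w))
        (n≢0⇒n>0 (adj⇒≢ G u∼v ∘ dist≡0⇒≡))
      ⇐closer (inj₂ (u∼w , w≢v)) = subst₂ _<_ (dist-sym u w) (dist-sym v w) du<dv
        where
        du≡1 : depth u ≡ 1
        du≡1 = ≤-antisym (subst (λ d → depth u ≤ suc d) depth-root (depth-adj u∼w))
                         (n≢0⇒n>0 (adj⇒≢ G u∼w ∘ depth≡0⇒root))
        du<dv : depth u < depth v
        du<dv with <-cmp (depth u) (depth v)
        ... | tri< du<dv _ _ = du<dv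
        ... | tri≈ _ du≡dv _ = ⊥-elim (adj⇒depth≢ u∼v du≡dv)
        ... | tri> _ _ dv<du = ⊥-elim (w≢v (sym (depth≡0⇒root (n<1⇒n≡0 (subst (depth v <_) du≡1 dv<du)))))
      closer⇒ : dist G w u < dist G w v → w ≡ u ⊎ (T (adj G u w) × w ≢ v)
      closer⇒ du<dv with w ≟ᶠ u | T? (adj G u w) ×-dec ¬? (w ≟ᶠ v)
      ... | yes w≡u | _                = inj₁ w≡u
      ... | no  _   | yes neighbour    = inj₂ neighbour
      ... | no  w≢u | no  ¬neighbour = ⊥-elim (<-asym du<dv (subst₂ _<_ (dist-sym v w) (dist-sym u w) v-above))
        where
        v-above = others-leaves⇒above (w≢u ∘ sym) u∼v λ q u∼q q≢v →
          (λ { refl → ¬neighbour (u∼q , q≢v) }) , leaves q u∼q q≢v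

    nClose-pendant : nClose G u v ≡ degree G u
    nClose-pendant = +-cancelʳ-≡ _ _ _ (begin
      nClose G u v + 1
        ≡⟨ cong₂ _+_ (nClose-as-∑ u v) (sym (∑-indicator-≡ v)) ⟩
      ∑[ w < n ] indicator (does (dist G w u <? dist G w v)) + ∑[ w < n ] indicator (does (w ≟ᶠ v))
        ≡⟨ ∑-distrib-+ (λ w → indicator (does (dist G w u <? dist G w v))) _ ⟨
      ∑[ w < n ] (indicator (does (dist G w u <? dist G w v)) + indicator (does (w ≟ᶠ v)))
        ≡⟨ sum-cong-≗ pointwise ⟩
      ∑[ w < n ] (indicator (does (w ≟ᶠ u)) + indicator (adj G u w))
        ≡⟨ ∑-distrib-+ (λ w → indicator (does (w ≟ᶠ u))) _ ⟩
      ∑[ w < n ] indicator (does (w ≟ᶠ u)) + degree G u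
        ≡⟨ cong (_+ degree G u) (∑-indicator-≡ u) ⟩
      1 + degree G u
        ≡⟨ +-comm 1 (degree G u) ⟩
      degree G u + 1 ∎)
      where
      open ≡-Reasoning
      pointwise : ∀ w → indicator (does (dist G w u <? dist G w v)) + indicator (does (w ≟ᶠ v)) ≡
                        indicator (does (w ≟ᶠ u)) + indicator (adj G u w)
      pointwise w with w ≟ᶠ u
      ... | yes refl
        rewrite dec-true (dist G u u <? dist G u v) (from (closer-to-u⇔ u) (inj₁ refl))
              | dec-false (u ≟ᶠ v) (adj⇒≢ G u∼v) | Graph.irrefl G u = refl
      ... | no w≢u with w ≟ᶠ v
      ...   | yes refl
        rewrite dec-false (dist G v u <? dist G v v)
                  (λ < → w≢u ([ id , (λ (_ , v≢v) → ⊥-elim (v≢v refl)) ] (to (closer-to-u⇔ v) <)))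
              | to T-≡ u∼v = refl
      ...   | no w≢v
        rewrite does≡ (dist G w u <? dist G w v) ([ (⊥-elim ∘ w≢u) , proj₁ ] ∘ to (closer-to-u⇔ w))
                      (λ u∼w → from (closer-to-u⇔ w) (inj₂ (u∼w , w≢v))) = +-identityʳ _

  module Upward (r : Fin n) where
    open RootedTree G connected acyclic r

    upward : Fin n → ℕ
    upward u = ∑[ v < n ] (if adj G u v ∧ ⌊ depth v <? depth u ⌋ then contribution u v else 0)

    Mo-upward : Mo G ≡ ∑ upward
    Mo-upward = Mo-by-key depth (λ u v → adj⇒depth≢)

    upward-root : upward r ≡ 0
    upward-root = ∑-zero _ nothing-below-root
      where
      nothing-below-root : ∀ v → (if adj G r v ∧ ⌊ depth v <? depth r ⌋ then contribution r v else 0) ≡ 0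
      nothing-below-root v with adj G r v
      ... | false = refl
      ... | true rewrite isYes-false (depth v <? depth r) (λ dv<dr → n≮0 (subst (depth v <_) depth-root dv<dr)) = refl

    upward-parent : ∀ {u p} → T (adj G u p) → depth p < depth u → upward u ≡ contribution u p
    upward-parent {u} {p} u∼p dp<du = trans (∑-single _ p only-parent) at-parent
      where
      at-parent : (if adj G u p ∧ ⌊ depth p <? depth u ⌋ then contribution u p else 0) ≡ contribution u p
      at-parent rewrite to T-≡ u∼p | isYes-true (depth p <? depth u) dp<du = refl
      only-parent : ∀ v → v ≢ p → (if adj G u v ∧ ⌊ depth v <? depth u ⌋ then contribution u v else 0) ≡ 0
      only-parent v v≢p with adj G u v in u∼v | depth v <? depth u
      ... | true  | yes dv<du = ⊥-elim (v≢p (lower-neighbour-unique (from T-≡ u∼v) u∼p dv<du dp<du))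
      ... | true  | no  _     = refl
      ... | false | _         = refl

    2∣upward+n : ∀ {u} → u ≢ r → 2 ∣ upward u + n
    2∣upward+n {u} u≢r with parent u≢r
    ... | p , u∼p , dp≡ =
      subst (2 ∣_) (sym (cong₂ _+_ (upward-parent u∼p (≤-reflexive dp≡)) (sym (nClose-complement u∼p))))
            (2∣∣m-n∣+[m+n] (nClose G u p) (nClose G p u))

Mo-even : ∀ {m} (G : Graph (suc m)) → Connected G → Acyclic G → 2 ∣ Mo G
Mo-even {m} G connected acyclic =
  ∣m+n∣m⇒∣n (subst (2 ∣_) Mo+m[1+m] (∑-∣ 2 _ (2∣upward+n ∘ fsuc≢fzero))) (2∣n*[1+n] m)
  where
  open TreeMostar.Upward G connected acyclic fzero
  fsuc≢fzero : ∀ i → fsuc i ≢ fzero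
  fsuc≢fzero i ()
  Mo+m[1+m] : ∑[ i < m ] (upward (fsuc i) + suc m) ≡ m * suc m + Mo G
  Mo+m[1+m] = begin
    ∑[ i < m ] (upward (fsuc i) + suc m)
      ≡⟨ ∑-distrib-+ (upward ∘ fsuc) _ ⟩
    ∑[ i < m ] upward (fsuc i) + ∑[ i < m ] suc m
      ≡⟨ cong₂ _+_ (cong (_+ ∑[ i < m ] upward (fsuc i)) (sym upward-root)) (∑-const m (suc m)) ⟩
    ∑ upward + m * suc m
      ≡⟨ +-comm _ (m * suc m) ⟩
    m * suc m + ∑ upward
      ≡⟨ cong (m * suc m +_) Mo-upward ⟨
    m * suc m + Mo G ∎
    where open ≡-Reasoning

-- Trees given by a parent function

module ParentTree (n : ℕ) (P : ℕ → ℕ) (P<id : ∀ i → 0 < i → P i < i) where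

  -- Vertex 0 has no parent: P 0 is never used.
  Child : ℕ → ℕ → Set
  Child i j = 0 < i × P i ≡ j

  child? : ∀ i j → Dec (Child i j)
  child? i j = 0 <? i ×-dec P i ≟ j

  Child-< : ∀ {i j} → Child i j → j < i
  Child-< (0<i , refl) = P<id _ 0<i

  ParentEdge : ℕ → ℕ → Set
  ParentEdge i j = Child j i ⊎ Child i j

  parentEdge? : ∀ i j → Dec (ParentEdge i j)
  parentEdge? i j = child? j i ⊎-dec child? i j

  ParentEdge-sym : ∀ {i j} → ParentEdge i j → ParentEdge j i
  ParentEdge-sym = swap

  ParentEdge-irrefl : ∀ i → ¬ ParentEdge i i
  ParentEdge-irrefl i = [ <-irrefl refl ∘ Child-< , <-irrefl refl ∘ Child-< ]

  tree : Graph n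
  tree = record
    { adj    = λ u v → does (parentEdge? (toℕ u) (toℕ v))
    ; sym    = λ u v → does-⇔ (parentEdge? (toℕ u) (toℕ v)) (parentEdge? (toℕ v) (toℕ u)) ParentEdge-sym ParentEdge-sym
    ; irrefl = λ u → dec-false (parentEdge? (toℕ u) (toℕ u)) (ParentEdge-irrefl (toℕ u))
    }

  ParentEdge⇒adj : ∀ {u v} → ParentEdge (toℕ u) (toℕ v) → T (adj tree u v)
  ParentEdge⇒adj {u} {v} = T-does⁺ (parentEdge? (toℕ u) (toℕ v))

  adj⇒ParentEdge : ∀ {u v} → T (adj tree u v) → ParentEdge (toℕ u) (toℕ v)
  adj⇒ParentEdge {u} {v} = T-does⁻ (parentEdge? (toℕ u) (toℕ v))

  lower-neighbour-is-parent : ∀ {u v} → T (adj tree u v) → toℕ v < toℕ u → P (toℕ u) ≡ toℕ v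
  lower-neighbour-is-parent u∼v v<u with adj⇒ParentEdge u∼v
  ... | inj₁ v-child = ⊥-elim (<-asym v<u (Child-< v-child))
  ... | inj₂ (_ , Pu≡v) = Pu≡v

  children : ℕ → ℕ
  children j = ∑[ w < n ] indicator (does (child? (toℕ w) j))

  degree-nonroot : ∀ {u} → 0 < toℕ u → degree tree u ≡ children (toℕ u) + 1
  degree-nonroot {u} 0<u = begin
    ∑[ w < n ] indicator (does (parentEdge? (toℕ u) (toℕ w)))
      ≡⟨ sum-cong-≗ {n} (λ w → indicator-⊎ (child? (toℕ w) (toℕ u)) (child? (toℕ u) (toℕ w))
                                              (λ w-child u-child → <-asym (Child-< w-child) (Child-< u-child))) ⟩
    ∑[ w < n ] (indicator (does (child? (toℕ w) (toℕ u))) + indicator (does (child? (toℕ u) (toℕ w))))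
      ≡⟨ ∑-distrib-+ {n} (λ w → indicator (does (child? (toℕ w) (toℕ u)))) _ ⟩
    children (toℕ u) + ∑[ w < n ] indicator (does (child? (toℕ u) (toℕ w)))
      ≡⟨ cong (children (toℕ u) +_) (trans (∑-single _ parentVertex not-parent) at-parent) ⟩
    children (toℕ u) + 1 ∎
    where
    open ≡-Reasoning
    Pu<n : P (toℕ u) < n
    Pu<n = <-trans (P<id _ 0<u) (toℕ<n u)
    parentVertex : Fin n
    parentVertex = fromℕ< Pu<n
    at-parent : indicator (does (child? (toℕ u) (toℕ parentVertex))) ≡ 1
    at-parent = cong indicator (dec-true (child? _ _) (0<u , sym (toℕ-fromℕ< Pu<n)))
    not-parent : ∀ w → w ≢ parentVertex → indicator (does (child? (toℕ u) (toℕ w))) ≡ 0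
    not-parent w w≢p = cong indicator (dec-false (child? _ _)
      (λ (_ , Pu≡w) → w≢p (toℕ-injective (trans (sym Pu≡w) (sym (toℕ-fromℕ< Pu<n))))))

  lower-neighbours-equal : ∀ {u a b} → T (adj tree u a) → T (adj tree u b) →
    toℕ a < toℕ u → toℕ b < toℕ u → a ≡ b
  lower-neighbours-equal u∼a u∼b a<u b<u =
    toℕ-injective (trans (sym (lower-neighbour-is-parent u∼a a<u)) (lower-neighbour-is-parent u∼b b<u))

  module _ (root : Fin n) (root≡0 : toℕ root ≡ 0) where

    walk-to-root : ∀ u → ∃ (Walk tree u root)
    walk-to-root u = go (suc (toℕ u)) u ≤-refl
      where
      go : ∀ fuel u → toℕ u < fuel → ∃ (Walk tree u root)
      go (suc fuel) u u<fuel with toℕ u ≟ 0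
      ... | yes u≡0 = _ , subst (λ x → Walk tree x root (root ∷ [])) (toℕ-injective (trans root≡0 (sym u≡0))) (here root)
      ... | no  u≢0 = _ , step (ParentEdge⇒adj (inj₂ (0<u , sym (toℕ-fromℕ< Pu<n)))) (proj₂ (go fuel (fromℕ< Pu<n) Pu<fuel))
        where
        0<u : 0 < toℕ u
        0<u = n≢0⇒n>0 u≢0
        Pu<n : P (toℕ u) < n
        Pu<n = <-trans (P<id _ 0<u) (toℕ<n u)
        Pu<fuel : toℕ (fromℕ< Pu<n) < fuel
        Pu<fuel = subst (_< fuel) (sym (toℕ-fromℕ< Pu<n)) (≤-trans (P<id _ 0<u) (s≤s⁻¹ u<fuel))

    connected : Connected tree
    connected u v = walk-++ (proj₂ (walk-to-root u)) (proj₂ (walk-reverse (proj₂ (walk-to-root v))))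

  -- An interior maximum of a simple walk would have two lower neighbours, both equal to its parent.
  simple-walk-max-at-end : ∀ {a b ls} → Walk tree a b ls → Unique ls →
    All (λ z → toℕ z ≤ toℕ a) ls ⊎ All (λ z → toℕ z ≤ toℕ b) ls
  simple-walk-max-at-end (here _) _ = inj₁ (≤-refl ∷ [])
  simple-walk-max-at-end {a} {b} (step {w = w} a∼w walk) (a∉ ∷ unique) with simple-walk-max-at-end walk unique
  ... | inj₂ below-b with toℕ a ≤? toℕ b
  ...   | yes a≤b = inj₂ (a≤b ∷ below-b)
  ...   | no  a≰b = inj₁ (≤-refl ∷ All.map (λ z≤b → ≤-trans z≤b (<⇒≤ (≰⇒> a≰b))) below-b)
  simple-walk-max-at-end {a} {b} (step {w = w} a∼w walk) (a∉ ∷ unique) | inj₁ below-w with toℕ w ≤? toℕ a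
  ... | yes w≤a = inj₁ (≤-refl ∷ All.map (λ z≤w → ≤-trans z≤w w≤a) below-w)
  ... | no  w≰a with walk | unique | below-w | a∉
  ...   | here _         | _      | _            | _        = inj₂ (<⇒≤ (≰⇒> w≰a) ∷ ≤-refl ∷ [])
  ...   | step w∼v walk′ | w∉ ∷ _ | _ ∷ below-w′ | _ ∷ a∉′ = ⊥-elim (All.lookup a∉′ v∈ a≡v)
    where
    v∈ = walk-first walk′
    a≡v = lower-neighbours-equal {w} {a} (adj-sym tree {a} {w} a∼w) w∼v (≰⇒> w≰a)
            (≤∧≢⇒< (All.lookup below-w′ v∈) (All.lookup w∉ v∈ ∘ toℕ-injective ∘ sym))

  -- The largest vertex of a cycle would have two distinct lower neighbours on it.
  acyclic : Acyclic tree
  acyclic (x , [] , _ , _ , _ , _ , ())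
  acyclic (x , _ ∷ [] , _ , _ , _ , _ , s≤s ())
  acyclic (x , w ∷ v ∷ rest , y , step x∼w walk@(step _ walk′) , y∼x , x∉ ∷ unique@(w∉ ∷ _) , _)
    with simple-walk-max-at-end (step x∼w walk) (x∉ ∷ unique)
  ... | inj₁ (_ ∷ below-x) = All.lookup w∉ (walk-last walk′)
          (lower-neighbours-equal {x} {w} {y} x∼w (adj-sym tree {y} {x} y∼x)
            (≤∧≢⇒< (All.head below-x) (All.head x∉ ∘ toℕ-injective ∘ sym))
            (≤∧≢⇒< (All.lookup below-x y∈) (All.lookup x∉ y∈ ∘ toℕ-injective ∘ sym)))
    where
    y∈ = walk-last walk
  ... | inj₂ (x≤y ∷ below-y) with walk-penultimate walk
  ...   | p , p∈ , p∼y = All.lookup x∉ p∈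
          (lower-neighbours-equal {y} {x} {p} y∼x (adj-sym tree {p} {y} p∼y)
            (≤∧≢⇒< x≤y (All.lookup x∉ (walk-last walk) ∘ toℕ-injective))
            (≤∧≢⇒< (All.lookup below-y p∈) (adj⇒≢ tree {p} {y} p∼y ∘ toℕ-injective)))

  isTree : 0 < n → IsTree tree
  isTree 0<n = 0<n , connected (fromℕ< 0<n) (toℕ-fromℕ< 0<n) , acyclic

module ShallowParentTree (m : ℕ) (P : ℕ → ℕ) (P<id : ∀ i → 0 < i → P i < i)
                         (height≤2 : ∀ i → 0 < P i → P (P i) ≡ 0) where
  open ParentTree (suc m) P P<id public
  open TreeMostar tree (connected fzero refl) acyclic
  open Upward fzero
  open RootedTree tree (connected fzero refl) acyclic fzero using (depth; others-leaves⇒above)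

  parentOf : Fin m → Fin (suc m)
  parentOf i = fromℕ< (≤-trans (P<id (suc (toℕ i)) (s≤s z≤n)) (s≤s (<⇒≤ (toℕ<n i))))

  toℕ-parentOf : ∀ i → toℕ (parentOf i) ≡ P (suc (toℕ i))
  toℕ-parentOf i = toℕ-fromℕ< _

  adj-parentOf : ∀ i → T (adj tree (fsuc i) (parentOf i))
  adj-parentOf i = ParentEdge⇒adj {fsuc i} {parentOf i} (inj₂ (s≤s z≤n , sym (toℕ-parentOf i)))

  other-neighbour-is-child : ∀ i {q} → T (adj tree (fsuc i) q) → q ≢ parentOf i → Child (toℕ q) (suc (toℕ i))
  other-neighbour-is-child i {q} u∼q q≢p with adj⇒ParentEdge {fsuc i} {q} u∼q
  ... | inj₁ q-child     = q-child
  ... | inj₂ (_ , Pu≡q) = ⊥-elim (q≢p (toℕ-injective (trans (sym Pu≡q) (sym (toℕ-parentOf i)))))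

  children-are-leaves : ∀ i → OtherNeighboursAreLeaves (fsuc i) (parentOf i)
  children-are-leaves i q u∼q q≢p z q∼z with other-neighbour-is-child i u∼q q≢p | adj⇒ParentEdge {q} {z} q∼z
  ... | 0<q , Pq≡u | inj₁ (_ , Pz≡q) = ⊥-elim (0≢1+n (trans (sym (height≤2 (toℕ z) (subst (0 <_) (sym Pz≡q) 0<q)))
                                                          (trans (cong P Pz≡q) Pq≡u)))
  ... | _   , Pq≡u | inj₂ (_ , Pq≡z) = toℕ-injective (trans (sym Pq≡z) Pq≡u)

  parentOf-above : ∀ i → depth (parentOf i) < depth (fsuc i)
  parentOf-above i = others-leaves⇒above (λ ()) (adj-parentOf i) λ q u∼q q≢p →
    (λ { refl → <-irrefl refl (proj₁ (other-neighbour-is-child i u∼q q≢p)) }) , children-are-leaves i q u∼q q≢p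

  -- |n_u - n_p| for the edge from u to its parent p when u has k children, all of them leaves: n_u = k + 1.
  pendantTerm : ℕ → ℕ
  pendantTerm k = ∣ suc k - (suc m ∸ suc k) ∣

  upward-nonroot : ∀ i → upward (fsuc i) ≡ pendantTerm (children (suc (toℕ i)))
  upward-nonroot i = begin
    upward (fsuc i)
      ≡⟨ upward-parent {u} {p} (adj-parentOf i) (parentOf-above i) ⟩
    ∣ nClose tree u p - nClose tree p u ∣
      ≡⟨ cong (λ k → ∣ nClose tree u p - k ∣) (sym (m+n≡o⇒o∸m≡n (nClose-complement {u} {p} (adj-parentOf i)))) ⟩
    pendantTerm′ (nClose tree u p)
      ≡⟨ cong pendantTerm′ (nClose-pendant {u} {p} (adj-parentOf i) (children-are-leaves i)) ⟩
    pendantTerm′ (degree tree u)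
      ≡⟨ cong pendantTerm′ (trans (degree-nonroot {u} (s≤s z≤n)) (+-comm _ 1)) ⟩
    pendantTerm (children (suc (toℕ i))) ∎
    where
    open ≡-Reasoning
    u = fsuc i
    p = parentOf i
    pendantTerm′ : ℕ → ℕ
    pendantTerm′ k = ∣ k - (suc m ∸ k) ∣
    m+n≡o⇒o∸m≡n : ∀ {x y z} → x + y ≡ z → z ∸ x ≡ y
    m+n≡o⇒o∸m≡n {x} {y} refl = m+n∸m≡n x y

  Mo-shallow : Mo tree ≡ ∑[ i < m ] pendantTerm (children (suc (toℕ i)))
  Mo-shallow = trans Mo-upward (cong₂ _+_ upward-root (sum-cong-≗ upward-nonroot))

-- Caterpillars

-- The parent of vertex 3 + i: the first a of these vertices hang from 1, the next c from 2, the rest from 0.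
legParent : ℕ → ℕ → ℕ → ℕ
legParent (suc a) c       zero    = 1
legParent (suc a) c       (suc i) = legParent a c i
legParent zero    (suc c) zero    = 2
legParent zero    (suc c) (suc i) = legParent zero c i
legParent zero    zero    i       = 0

legParent≤2 : ∀ a c i → legParent a c i ≤ 2
legParent≤2 (suc a) c       zero    = s≤s z≤n
legParent≤2 (suc a) c       (suc i) = legParent≤2 a c i
legParent≤2 zero    (suc c) zero    = ≤-refl
legParent≤2 zero    (suc c) (suc i) = legParent≤2 zero c i
legParent≤2 zero    zero    i       = z≤n

legParent-first : ∀ a c i → i < a → legParent a c i ≡ 1
legParent-first (suc a) c zero    _         = refl
legParent-first (suc a) c (suc i) (s≤s i<a) = legParent-first a c i i<a

legParent-second : ∀ a c i → i < c → legParent a c (a + i) ≡ 2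
legParent-second (suc a) c       i       i<c       = legParent-second a c i i<c
legParent-second zero    (suc c) zero    _         = refl
legParent-second zero    (suc c) (suc i) (s≤s i<c) = legParent-second zero c i i<c

legParent-rest : ∀ a c i → legParent a c (a + (c + i)) ≡ 0
legParent-rest (suc a) c       i = legParent-rest a c i
legParent-rest zero    (suc c) i = legParent-rest zero c i
legParent-rest zero    zero    i = refl

module Caterpillar (a b c : ℕ) where

  s : ℕ
  s = a + (c + b)

  P : ℕ → ℕ
  P (suc (suc (suc i))) = legParent a c i
  P _                   = 0

  P≤2 : ∀ i → P i ≤ 2
  P≤2 0                   = z≤n
  P≤2 1                   = z≤n
  P≤2 2                   = z≤n
  P≤2 (suc (suc (suc i))) = legParent≤2 a c i

  P<id : ∀ i → 0 < i → P i < i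
  P<id 1                   _ = s≤s z≤n
  P<id 2                   _ = s≤s z≤n
  P<id (suc (suc (suc i))) _ = s≤s (≤-trans (legParent≤2 a c i) (s≤s (s≤s z≤n)))

  height≤2 : ∀ i → 0 < P i → P (P i) ≡ 0
  height≤2 i _ with P i | P≤2 i
  ... | 0 | _ = refl
  ... | 1 | _ = refl
  ... | 2 | _ = refl
  ... | suc (suc (suc _)) | s≤s (s≤s ())

  open ShallowParentTree (suc (suc s)) P P<id height≤2 public

  legs : ℕ → ℕ
  legs 1 = a
  legs 2 = c
  legs _ = 0

  legCount : ∀ j → ∑[ i < s ] indicator (does (legParent a c (toℕ i) ≟ j)) ≡
    a * indicator (does (1 ≟ j)) + (c * indicator (does (2 ≟ j)) + b * indicator (does (0 ≟ j)))
  legCount j = begin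
    ∑[ i < a + (c + b) ] count (toℕ i)
      ≡⟨ ∑-toℕ-+ a (c + b) count ⟩
    ∑[ i < a ] count (toℕ i) + ∑[ i < c + b ] count (a + toℕ i)
      ≡⟨ cong (∑[ i < a ] count (toℕ i) +_) (∑-toℕ-+ c b (count ∘ (a +_))) ⟩
    ∑[ i < a ] count (toℕ i) + (∑[ i < c ] count (a + toℕ i) + ∑[ i < b ] count (a + (c + toℕ i)))
      ≡⟨ cong₂ _+_ (constant a id (λ i → legParent-first a c (toℕ i) (toℕ<n i)))
                   (cong₂ _+_ (constant c (a +_) (λ i → legParent-second a c (toℕ i) (toℕ<n i)))
                              (constant b (λ i → a + (c + i)) (λ i → legParent-rest a c (toℕ i)))) ⟩
    a * indicator (does (1 ≟ j)) + (c * indicator (does (2 ≟ j)) + b * indicator (does (0 ≟ j))) ∎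
    where
    open ≡-Reasoning
    count : ℕ → ℕ
    count i = indicator (does (legParent a c i ≟ j))
    constant : ∀ k (f : ℕ → ℕ) {v} → (∀ (i : Fin k) → legParent a c (f (toℕ i)) ≡ v) →
      ∑[ i < k ] count (f (toℕ i)) ≡ k * indicator (does (v ≟ j))
    constant k f f≡v = trans (sum-cong-≗ (λ i → cong (λ x → indicator (does (x ≟ j))) (f≡v i))) (∑-const k _)

  -- Vertices 0, 1 and 2 have parent 0, so children (suc k) unfolds to the count over the legs.
  children-legs : ∀ k → children (suc k) ≡ legs (suc k)
  children-legs 0             = trans (legCount 1) (first a b c)
    where
    first : ∀ a b c → a * 1 + (c * 0 + b * 0) ≡ a
    first = solve-∀
  children-legs 1             = trans (legCount 2) (second a b c)
    where
    second : ∀ a b c → a * 0 + (c * 1 + b * 0) ≡ c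
    second = solve-∀
  children-legs (suc (suc k)) = trans (legCount (3 + k)) (neither a b c)
    where
    neither : ∀ a b c → a * 0 + (c * 0 + b * 0) ≡ 0
    neither = solve-∀

  Mo-caterpillar : Mo tree ≡ pendantTerm a + (pendantTerm c + s * suc s)
  Mo-caterpillar = begin
    Mo tree
      ≡⟨ Mo-shallow ⟩
    pendantTerm (children 1) + (pendantTerm (children 2) + ∑[ i < s ] pendantTerm (children (3 + toℕ i)))
      ≡⟨ cong₂ _+_ (cong pendantTerm (children-legs 0))
                   (cong₂ _+_ (cong pendantTerm (children-legs 1))
                              (trans (sum-cong-≗ {s} (λ i → cong pendantTerm (children-legs (2 + toℕ i))))
                                     (∑-const s (suc s)))) ⟩
    pendantTerm a + (pendantTerm c + s * suc s) ∎
    where open ≡-Reasoning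

  Mo-balanced : a ≤ suc (c + b) → c ≤ suc (a + b) → Mo tree ≡ 2 * suc b + s * suc s
  Mo-balanced a≤ c≤ = begin
    Mo tree
      ≡⟨ Mo-caterpillar ⟩
    pendantTerm a + (pendantTerm c + s * suc s)
      ≡⟨ +-assoc (pendantTerm a) _ _ ⟨
    pendantTerm a + pendantTerm c + s * suc s
      ≡⟨ cong (_+ s * suc s) (cong₂ _+_ (pendantTerm-balanced a (c + b) a≤)
           (trans (cong (λ x → ∣ suc c - (suc (suc x) ∸ c) ∣) (x+[y+z]≡y+[x+z] a c b))
                  (pendantTerm-balanced c (a + b) c≤))) ⟩
    (suc (c + b) ∸ a) + (suc (a + b) ∸ c) + s * suc s
      ≡⟨ cong (_+ s * suc s) (+-cancelʳ-≡ (a + c) _ _ legs-cancel) ⟩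
    2 * suc b + s * suc s ∎
    where
    open ≡-Reasoning
    x+[y+z]≡y+[x+z] : ∀ x y z → x + (y + z) ≡ y + (x + z)
    x+[y+z]≡y+[x+z] = solve-∀
    pendantTerm-balanced : ∀ k x → k ≤ suc x → ∣ suc k - (suc (suc (k + x)) ∸ k) ∣ ≡ suc x ∸ k
    pendantTerm-balanced k x k≤ = begin
      ∣ suc k - (suc (suc (k + x)) ∸ k) ∣
        ≡⟨ cong (λ y → ∣ suc k - y ∣) (trans (cong (_∸ k) k+2+x) (m+n∸m≡n k _)) ⟩
      ∣ k - suc x ∣
        ≡⟨ ∣-∣≡ℕ∣-∣ k (suc x) ⟩
      ℕ.∣ k - suc x ∣
        ≡⟨ m≤n⇒∣m-n∣≡n∸m k≤ ⟩
      suc x ∸ k ∎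
      where
      k+2+x : suc (suc (k + x)) ≡ k + suc (suc x)
      k+2+x = sym (trans (+-suc k (suc x)) (cong suc (+-suc k x)))
    legs-cancel : (suc (c + b) ∸ a) + (suc (a + b) ∸ c) + (a + c) ≡ 2 * suc b + (a + c)
    legs-cancel = begin
      (suc (c + b) ∸ a) + (suc (a + b) ∸ c) + (a + c) ≡⟨ regroup (suc (c + b) ∸ a) (suc (a + b) ∸ c) a c ⟩
      (suc (c + b) ∸ a + a) + (suc (a + b) ∸ c + c)   ≡⟨ cong₂ _+_ (m∸n+n≡m a≤) (m∸n+n≡m c≤) ⟩
      suc (c + b) + suc (a + b)                       ≡⟨ both-legs a b c ⟩
      2 * suc b + (a + c)                             ∎
      where
      regroup : ∀ x y a c → x + y + (a + c) ≡ (x + a) + (y + c)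
      regroup = solve-∀
      both-legs : ∀ a b c → suc (c + b) + suc (a + b) ≡ 2 * suc b + (a + c)
      both-legs = solve-∀

-- Writing m = triangle s + b with b ≤ s, the caterpillar with b legs at the centre and the
-- remaining s - b legs split evenly between the two ends has Mostar index s (s + 1) + 2 (b + 1).
positive-even-realised : ∀ m → Σ ℕ λ n → Σ (Graph n) λ G → IsTree G × Mo G ≡ suc m * 2
positive-even-realised m with triangular-decomposition m
... | s , b , b≤s , T+b≡m = _ , tree , isTree (s≤s z≤n) , Mo≡
  where
  t = s ∸ b
  open Caterpillar ⌊ t /2⌋ b ⌈ t /2⌉ using (tree; isTree; Mo-balanced)
  spine≡s : ⌊ t /2⌋ + (⌈ t /2⌉ + b) ≡ s
  spine≡s = trans (sym (+-assoc ⌊ t /2⌋ _ b)) (trans (cong (_+ b) (⌊n/2⌋+⌈n/2⌉≡n t)) (m∸n+n≡m b≤s))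
  Mo≡ : Mo tree ≡ suc m * 2
  Mo≡ = begin
    Mo tree
      ≡⟨ Mo-balanced (≤-trans (⌊n/2⌋≤⌈n/2⌉ t) (≤-trans (m≤m+n _ b) (n≤1+n _)))
                     (≤-trans (⌈n/2⌉≤1+⌊n/2⌋ t) (s≤s (m≤m+n _ b))) ⟩
    2 * suc b + spine * suc spine
      ≡⟨ cong (λ x → 2 * suc b + x * suc x) spine≡s ⟩
    2 * suc b + s * suc s
      ≡⟨ cong (2 * suc b +_) (triangle-double s) ⟨
    2 * suc b + (triangle s + triangle s)
      ≡⟨ regroup b (triangle s) ⟩
    suc (triangle s + b) * 2
      ≡⟨ cong (λ x → suc x * 2) T+b≡m ⟩
    suc m * 2 ∎
    where
    open ≡-Reasoning
    spine = ⌊ t /2⌋ + (⌈ t /2⌉ + b)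
    regroup : ∀ b t → 2 * suc b + (t + t) ≡ suc (t + b) * 2
    regroup = solve-∀

module SingleVertex = ParentTree 1 (λ _ → 0) (λ _ 0<i → 0<i)

mainTheorem10 : (p : ℕ) →
    (Σ ℕ λ n → Σ (Graph n) λ G → IsTree G × Mo G ≡ p) ⇔ (2 ∣ p)
mainTheorem10 p = mk⇔ tree⇒even even⇒tree
  where
  tree⇒even : (Σ ℕ λ n → Σ (Graph n) λ G → IsTree G × Mo G ≡ p) → 2 ∣ p
  tree⇒even (zero  , _ , (() , _) , _)
  tree⇒even (suc _ , G , (_ , connected , acyclic) , refl) = Mo-even G connected acyclic
  even⇒tree : 2 ∣ p → Σ ℕ λ n → Σ (Graph n) λ G → IsTree G × Mo G ≡ p
  even⇒tree (divides zero    refl) = 1 , SingleVertex.tree , SingleVertex.isTree (s≤s z≤n) , refl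
  even⇒tree (divides (suc m) refl) = positive-even-realised m
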